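{- For every integer $\alpha\geq 1$ there exists a graph $G$ with independence number $\alpha$ and order $n$ such that $\mathrm{th}_{\mathrm{H}}(G)=\lceil n-\alpha+2\sqrt{\alpha}-1\rceil$. (That is, the general upper bound $\mathrm{th}_{\mathrm{H}}(G)\leq \lceil n-\alpha+2\sqrt{\alpha}-1\rceil$, valid for every graph of order $n$ and independence number $\alpha$, is tight for all $\alpha\geq 1$.)
   Context: All graphs are finite, simple and undirected; $N(v)$ is the open neighborhood of $v$. Vertices are colored blue or white. Under the hopping color change rule, a blue vertex $v$ may force a white vertex $w$ (not necessarily adjacent to $v$) to become blue provided $v$ has not previously performed a force and every vertex of $N(v)$ is blue. Starting from an initial blue set $B\subseteq V(G)$, a chronological list of forces is a sequence of valid forces performed one at a time until no further force is possible; its unordered set of forces is a set of forces of $B$. $B$ is a hopping forcing set if some chronological list turns every vertex blue. For a set of forces $\mathcal F$ of $B$, put $\mathcal F^{(0)}=B$ and, for $t>0$, let $\mathcal F^{(t)}$ be the set of vertices $w$ for which there is a force $v\to w$ in $\mathcal F$ with $v\in\bigcup_{i<t}\mathcal F^{(i)}$ that is a valid hopping force when exactly the vertices of $\bigcup_{i<t}\mathcal F^{(i)}$ are blue. $\mathrm{pt}_{\mathrm{H}}(G;\mathcal F)$ is the least $t$ with $\bigcup_{i\le t}\mathcal F^{(i)}=V(G)$, and $\mathrm{pt}_{\mathrm{H}}(G;B)$ is the minimum of $\mathrm{pt}_{\mathrm{H}}(G;\mathcal F)$ over sets of forces $\mathcal F$ of $B$ ($\infty$ if $B$ is not a hopping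 forcing set). The hopping throttling number is $\mathrm{th}_{\mathrm{H}}(G)=\min_{B\subseteq V(G)}\big(|B|+\mathrm{pt}_{\mathrm{H}}(G;B)\big)$. -}

module Defs where

open import Data.Nat using (ℕ; zero; suc; _+_; _*_; _≤_)
open import Data.Bool using (Bool; true; false)
open import Data.Fin using (Fin)
open import Data.Fin.Subset using (Subset; _∈_; _∉_; ⁅_⁆; _∪_; ∣_∣; ⊥)
open import Data.List using (List; []; _∷_)
open import Data.List.Membership.Propositional using () renaming (_∈_ to _∈ₗ_)
open import Data.Product using (Σ; _×_; _,_)
open import Data.Sum using (_⊎_)
open import Relation.Nullary using (¬_)
open import Relation.Binary.PropositionalEquality using (_≡_)

record Graph (n : ℕ) : Set where
  field
    adj     : Fin n → Fin n → Bool
    symm    : ∀ u v → adj u v ≡ adj v u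
    irrefl  : ∀ v → adj v v ≡ false

open Graph public

Adj : ∀ {n} → Graph n → Fin n → Fin n → Set
Adj G u v = adj G u v ≡ true

NbhdIn : ∀ {n} → Graph n → Subset n → Fin n → Set
NbhdIn G S v = ∀ u → Adj G v u → u ∈ S

-- Hopping force v → w, with current blue set S and set D of vertices
-- that have already performed a force.
ValidForce : ∀ {n} → Graph n → Subset n → Subset n → Fin n → Fin n → Set
ValidForce G S D v w = v ∈ S × w ∉ S × v ∉ D × NbhdIn G S v

data Chrono {n : ℕ} (G : Graph n) : Subset n → Subset n → List (Fin n × Fin n) → Set where
  done : ∀ {S D} → (∀ v w → ¬ ValidForce G S D v w) → Chrono G S D []
  step : ∀ {S D v w fs} → ValidForce G S D v w →
         Chrono G (S ∪ ⁅ w ⁆) (D ∪ ⁅ v ⁆) fs → Chrono G S D ((v , w) ∷ fs)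

-- fs (read as an unordered set of forces) is a set of forces of B.
IsSetOfForces : ∀ {n} → Graph n → Subset n → List (Fin n × Fin n) → Set
IsSetOfForces G B fs = Chrono G B ⊥ fs

BlueBy : ∀ {n} → Graph n → Subset n → List (Fin n × Fin n) → ℕ → Fin n → Set
BlueBy G B fs zero w = w ∈ B
BlueBy G B fs (suc t) w =
  BlueBy G B fs t w ⊎
  Σ (Fin _) (λ v → ((v , w) ∈ₗ fs) × BlueBy G B fs t v × ¬ BlueBy G B fs t w
                 × (∀ u → Adj G v u → BlueBy G B fs t u))

AllBlueBy : ∀ {n} → Graph n → Subset n → List (Fin n × Fin n) → ℕ → Set
AllBlueBy G B fs t = ∀ w → BlueBy G B fs t w

IsPTForces : ∀ {n} → Graph n → Subset n → List (Fin n × Fin n) → ℕ → Set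
IsPTForces G B fs t = AllBlueBy G B fs t × (∀ s → AllBlueBy G B fs s → t ≤ s)

IsHoppingThrottling : ∀ {n} → Graph n → ℕ → Set
IsHoppingThrottling {n} G k =
  Σ (Subset n) (λ B → Σ (List (Fin n × Fin n)) (λ fs → Σ ℕ (λ t →
      IsSetOfForces G B fs × IsPTForces G B fs t × ∣ B ∣ + t ≡ k)))
  × (∀ (B : Subset n) fs t → IsSetOfForces G B fs → IsPTForces G B fs t → k ≤ ∣ B ∣ + t)

IsIndependent : ∀ {n} → Graph n → Subset n → Set
IsIndependent G S = ∀ u v → u ∈ S → v ∈ S → ¬ Adj G u v

IsIndependenceNumber : ∀ {n} → Graph n → ℕ → Set
IsIndependenceNumber {n} G a =
  Σ (Subset n) (λ S → IsIndependent G S × ∣ S ∣ ≡ a)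
  × (∀ (S : Subset n) → IsIndependent G S → ∣ S ∣ ≤ a)

-- c = ⌈ 2 √a ⌉ , i.e. c is the least natural number with 4a ≤ c².
IsCeilTwoSqrt : ℕ → ℕ → Set
IsCeilTwoSqrt a c = 4 * a ≤ c * c × (∀ d → 4 * a ≤ d * d → c ≤ d)

-- In a chronological list of hopping forces every vertex forces at most once,
-- so the forces form chains starting in B, and a vertex that is blue at time t
-- is determined by the start of its chain and its position (at most t) in it.
-- Hence n ≤ |B| (t + 1), and by AM-GM |B| + (t + 1) ≥ ⌈2√n⌉. The edgeless graph
-- on α vertices attains this: with B the first b vertices, vertex i hops onto
-- vertex i + b, so after t rounds (t + 1) b vertices are blue; choosing b and
-- t + 1 as the two halves of ⌈2√α⌉ makes (t + 1) b ≥ α.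
module Submission where

open import Defs
open import Data.Nat using (ℕ; _+_; _≤_)
open import Data.Product using (Σ; _×_)
open import Relation.Binary.PropositionalEquality using (_≡_)

open import Data.Nat using (zero; suc; _*_; _∸_; _<_; z≤n; s≤s; s≤s⁻¹; _≤?_; _<?_)
open import Data.Nat.Properties
open import Data.Nat.Tactic.RingSolver using (solve-∀)
open import Data.Fin using (Fin; zero; suc; toℕ; fromℕ<; combine)
open import Data.Fin.Properties
  using (toℕ-fromℕ<; toℕ<n; toℕ-injective; fromℕ<-injective; combine-injective; injective⇒≤)
  renaming (suc-injective to Fin-suc-injective)
open import Data.Fin.Subset using (Subset; _∈_; _∉_; ⁅_⁆; _∪_; ∣_∣; ⊤; inside; outside)
  renaming (⊥ to ∅)
open import Data.Fin.Subset.Properties using (x∈⁅x⁆; p⊆p∪q; q⊆p∪q; ∣⊤∣≡n; ∣p∣≤n; ∪-identityʳ)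
open import Data.Bool using (false)
open import Data.Vec using ([]; _∷_; here; there)
open import Data.List using (List; []; _∷_)
open import Data.List.Relation.Unary.Any using (here; there)
open import Data.List.Membership.Propositional using () renaming (_∈_ to _∈ₗ_)
open import Data.Product using (_,_)
open import Data.Sum using (_⊎_; inj₁; inj₂; [_,_]′)
open import Data.Empty using (⊥-elim)
open import Function using (_∘_)
open import Relation.Nullary using (¬_; yes; no)
open import Relation.Unary using (Decidable)
open import Relation.Binary.PropositionalEquality
  using (refl; sym; trans; cong; subst; subst₂; module ≡-Reasoning)

private variable
  n : ℕ

forcer-unused : {G : Graph n} {S D : Subset n} {fs : List (Fin n × Fin n)} {v w : Fin n} →
  Chrono G S D fs → (v , w) ∈ₗ fs → v ∉ D
forcer-unused (step (_ , _ , v∉D , _) _) (here refl) = v∉D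
forcer-unused (step {v = u} _ c) (there m) = forcer-unused c m ∘ p⊆p∪q ⁅ u ⁆

forced-unique : {G : Graph n} {S D : Subset n} {fs : List (Fin n × Fin n)} {v w w′ : Fin n} →
  Chrono G S D fs → (v , w) ∈ₗ fs → (v , w′) ∈ₗ fs → w ≡ w′
forced-unique c (here refl) (here refl) = refl
forced-unique (step {v = v} _ c) (here refl) (there m) =
  ⊥-elim (forcer-unused c m (q⊆p∪q _ ⁅ v ⁆ (x∈⁅x⁆ v)))
forced-unique (step {v = v} _ c) (there m) (here refl) =
  ⊥-elim (forcer-unused c m (q⊆p∪q _ ⁅ v ⁆ (x∈⁅x⁆ v)))
forced-unique (step _ c) (there m) (there m′) = forced-unique c m m′

module ForcingChains (G : Graph n) (B : Subset n) (fs : List (Fin n × Fin n)) where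

  root : ∀ t w → BlueBy G B fs t w → Fin n
  root zero    w _                       = w
  root (suc t) w (inj₁ p)                = root t w p
  root (suc t) w (inj₂ (v , _ , p , _))  = root t v p

  depth : ∀ t w → BlueBy G B fs t w → ℕ
  depth zero    w _                      = 0
  depth (suc t) w (inj₁ p)               = depth t w p
  depth (suc t) w (inj₂ (v , _ , p , _)) = suc (depth t v p)

  root∈B : ∀ t w p → root t w p ∈ B
  root∈B zero    w p                      = p
  root∈B (suc t) w (inj₁ p)               = root∈B t w p
  root∈B (suc t) w (inj₂ (v , _ , p , _)) = root∈B t v p

  depth≤time : ∀ t w p → depth t w p ≤ t
  depth≤time zero    w p                      = z≤n
  depth≤time (suc t) w (inj₁ p)               = m≤n⇒m≤1+n (depth≤time t w p)
  depth≤time (suc t) w (inj₂ (v , _ , p , _)) = s≤s (depth≤time t v p)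

  root-depth-injective :
    (∀ {v w w′} → (v , w) ∈ₗ fs → (v , w′) ∈ₗ fs → w ≡ w′) →
    ∀ t t′ w w′ (p : BlueBy G B fs t w) (p′ : BlueBy G B fs t′ w′) →
    root t w p ≡ root t′ w′ p′ → depth t w p ≡ depth t′ w′ p′ → w ≡ w′
  root-depth-injective uniq zero zero w w′ p p′ r d = r
  root-depth-injective uniq zero (suc t′) w w′ p (inj₁ p′) r d =
    root-depth-injective uniq zero t′ w w′ p p′ r d
  root-depth-injective uniq (suc t) t′ w w′ (inj₁ p) p′ r d =
    root-depth-injective uniq t t′ w w′ p p′ r d
  root-depth-injective uniq (suc t) (suc t′) w w′ (inj₂ q) (inj₁ p′) r d =
    root-depth-injective uniq (suc t) t′ w w′ (inj₂ q) p′ r d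
  root-depth-injective uniq (suc t) (suc t′) w w′ (inj₂ (v , m , p , _)) (inj₂ (v′ , m′ , p′ , _)) r d
    with refl ← root-depth-injective uniq t t′ v v′ p p′ r (suc-injective d) = uniq m m′

position : (S : Subset n) (x : Fin n) → x ∈ S → Fin ∣ S ∣
position (inside ∷ S)  zero    here      = zero
position (inside ∷ S)  (suc x) (there m) = suc (position S x m)
position (outside ∷ S) (suc x) (there m) = position S x m

position-injective : (S : Subset n) (x y : Fin n) (m : x ∈ S) (m′ : y ∈ S) →
  position S x m ≡ position S y m′ → x ≡ y
position-injective (inside ∷ S)  zero    zero    here      here       _ = refl
position-injective (inside ∷ S)  (suc x) (suc y) (there m) (there m′) e =
  cong suc (position-injective S x y m m′ (Fin-suc-injective e))
position-injective (outside ∷ S) (suc x) (suc y) (there m) (there m′) e =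
  cong suc (position-injective S x y m m′ e)

order≤[1+time]*size : (G : Graph n) (B : Subset n) (fs : List (Fin n × Fin n)) (t : ℕ) →
  IsSetOfForces G B fs → AllBlueBy G B fs t → n ≤ suc t * ∣ B ∣
order≤[1+time]*size {n} G B fs t chrono blue = injective⇒≤ {f = chainIndex} chainIndex-injective
  where
  open ForcingChains G B fs
  chainIndex : Fin n → Fin (suc t * ∣ B ∣)
  chainIndex w = combine (fromℕ< (s≤s (depth≤time t w (blue w))))
                         (position B (root t w (blue w)) (root∈B t w (blue w)))
  chainIndex-injective : ∀ {x y} → chainIndex x ≡ chainIndex y → x ≡ y
  chainIndex-injective {x} {y} eq with d≡ , r≡ ← combine-injective _ _ _ _ eq =
    root-depth-injective (forced-unique chrono) t t x y (blue x) (blue y)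
      (position-injective B _ _ _ _ r≡) (fromℕ<-injective _ _ _ _ d≡)

4*xy≤[x+y]² : ∀ x y → 4 * (x * y) ≤ (x + y) * (x + y)
4*xy≤[x+y]² x y =
  [ ordered , (λ y≤x → subst₂ (λ u v → 4 * u ≤ v * v) (*-comm y x) (+-comm y x) (ordered y≤x)) ]′
    (≤-total x y)
  where
  square : ∀ x d → (x + (x + d)) * (x + (x + d)) ≡ 4 * (x * (x + d)) + d * d
  square = solve-∀
  ordered : ∀ {x y} → x ≤ y → 4 * (x * y) ≤ (x + y) * (x + y)
  ordered {x} {y} x≤y = subst (λ y → 4 * (x * y) ≤ (x + y) * (x + y)) (m+[n∸m]≡n x≤y)
    (subst (4 * (x * (x + (y ∸ x))) ≤_) (sym (square x (y ∸ x))) (m≤m+n _ _))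

ceil2√≤sum : ∀ {a c x y} → IsCeilTwoSqrt a c → a ≤ x * y → c ≤ x + y
ceil2√≤sum {x = x} {y} (_ , least) a≤xy = least (x + y) (≤-trans (*-monoʳ-≤ 4 a≤xy) (4*xy≤[x+y]² x y))

ceil2√≤suc[size+time] : ∀ {c} (G : Graph n) (B : Subset n) (fs : List (Fin n × Fin n)) (t : ℕ) →
  IsCeilTwoSqrt n c → IsSetOfForces G B fs → AllBlueBy G B fs t → c ≤ suc (∣ B ∣ + t)
ceil2√≤suc[size+time] G B fs t ceil chrono blue =
  ≤-trans (ceil2√≤sum {x = suc t} {∣ B ∣} ceil (order≤[1+time]*size G B fs t chrono blue))
          (≤-reflexive (trans (+-comm (suc t) ∣ B ∣) (+-suc ∣ B ∣ t)))

minimal-witness-or-none : {P : ℕ → Set} → Decidable P → ∀ k →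
  Σ ℕ (λ c → P c × (∀ d → P d → c ≤ d)) ⊎ (∀ d → d < k → ¬ P d)
minimal-witness-or-none P? zero = inj₂ (λ _ ())
minimal-witness-or-none P? (suc k) with minimal-witness-or-none P? k | P? k
... | inj₁ found | _     = inj₁ found
... | inj₂ none  | yes p = inj₁ (k , p , λ d pd → ≮⇒≥ (λ d<k → none d d<k pd))
... | inj₂ none  | no ¬p = inj₂ λ d d<1+k pd → [ (λ d<k → none d d<k pd) , (λ { refl → ¬p pd }) ]′
                                                 (m≤n⇒m<n∨m≡n (s≤s⁻¹ d<1+k))

minimal-witness : {P : ℕ → Set} → Decidable P → ∀ {k} → P k → Σ ℕ (λ c → P c × (∀ d → P d → c ≤ d))
minimal-witness P? {k} pk with minimal-witness-or-none P? k
... | inj₁ found = found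
... | inj₂ none  = k , pk , λ d pd → ≮⇒≥ (λ d<k → none d d<k pd)

ceil2√-exists : ∀ a → Σ ℕ (IsCeilTwoSqrt a)
ceil2√-exists a = minimal-witness (λ d → 4 * a ≤? d * d) {suc (4 * a)}
  (≤-trans (n≤1+n (4 * a)) (m≤m*n (suc (4 * a)) (suc (4 * a))))

parity : ∀ c → Σ ℕ (λ x → x + x ≡ c) ⊎ Σ ℕ (λ x → suc (x + x) ≡ c)
parity zero = inj₁ (0 , refl)
parity (suc c) with parity c
... | inj₁ (x , refl) = inj₂ (x , refl)
... | inj₂ (x , refl) = inj₁ (suc x , cong suc (+-suc x x))

halves : ∀ c → Σ ℕ λ x → Σ ℕ λ y → x + y ≡ c × x ≤ y × (x + y) * (x + y) ≤ suc (4 * (x * y))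
halves c with parity c
... | inj₁ (x , x+x≡c) = x , x , x+x≡c , ≤-refl , ≤-trans (≤-reflexive (even x)) (n≤1+n _)
  where
  even : ∀ x → (x + x) * (x + x) ≡ 4 * (x * x)
  even = solve-∀
... | inj₂ (x , 1+x+x≡c) = x , suc x , trans (+-suc x x) 1+x+x≡c , n≤1+n x , ≤-reflexive (odd x)
  where
  odd : ∀ x → (x + suc x) * (x + suc x) ≡ suc (4 * (x * suc x))
  odd = solve-∀

4*m≤1+4*k⇒m≤k : ∀ {m k} → 4 * m ≤ suc (4 * k) → m ≤ k
4*m≤1+4*k⇒m≤k {m} {k} h = s≤s⁻¹ (*-cancelˡ-< 4 m (suc k) (≤-<-trans h 1+4k<4[1+k]))
  where
  1+4k<4[1+k] : suc (4 * k) < 4 * suc k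
  1+4k<4[1+k] = subst (suc (4 * k) <_) (sym (*-suc 4 k)) (+-monoˡ-≤ (4 * k) {2} {4} (s≤s (s≤s z≤n)))

m+m≤n+n⇒m≤n : ∀ {m n} → m + m ≤ n + n → m ≤ n
m+m≤n+n⇒m≤n h = ≮⇒≥ (λ n<m → ≤⇒≯ h (+-mono-< n<m n<m))

ceil2√-split : ∀ {a c} → 1 ≤ a → IsCeilTwoSqrt a c →
  Σ ℕ λ b → Σ ℕ λ t → 1 ≤ b × b ≤ a × a ≤ suc t * b × suc (b + t) ≡ c
ceil2√-split {a} {c} 1≤a (4a≤c² , least) with halves c
... | x , y , x+y≡c , x≤y , c²≤1+4xy = split x y x+y≡c x≤y a≤xy
  where
  a≤xy : a ≤ x * y
  a≤xy = 4*m≤1+4*k⇒m≤k (≤-trans 4a≤c² (subst (λ c → c * c ≤ _) x+y≡c c²≤1+4xy))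
  c≤a+a : c ≤ a + a
  c≤a+a = least (a + a) (subst (_≤ (a + a) * (a + a)) (*-identityʳ (4 * a))
                            (subst (4 * a * 1 ≤_) (sym (double a)) (*-monoʳ-≤ (4 * a) 1≤a)))
    where
    double : ∀ a → (a + a) * (a + a) ≡ 4 * a * a
    double = solve-∀
  split : ∀ x y → x + y ≡ c → x ≤ y → a ≤ x * y →
          Σ ℕ λ b → Σ ℕ λ t → 1 ≤ b × b ≤ a × a ≤ suc t * b × suc (b + t) ≡ c
  split zero y _ _ a≤0 = ⊥-elim (<⇒≱ 1≤a a≤0)
  split (suc x) zero _ () _
  split (suc x) (suc y) x+y≡c x≤y a≤xy =
    suc x , y , s≤s z≤n ,
    m+m≤n+n⇒m≤n (≤-trans (+-monoʳ-≤ (suc x) x≤y) (subst (_≤ a + a) (sym x+y≡c) c≤a+a)) ,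
    subst (a ≤_) (*-comm (suc x) (suc y)) a≤xy ,
    trans (sym (+-suc (suc x) y)) x+y≡c

edgeless : (n : ℕ) → Graph n
edgeless n = record { adj = λ _ _ → false ; symm = λ _ _ → refl ; irrefl = λ _ → refl }

edgeless-independenceNumber : ∀ n → IsIndependenceNumber (edgeless n) n
edgeless-independenceNumber n = (⊤ , (λ _ _ _ _ ()) , ∣⊤∣≡n n) , (λ S _ → ∣p∣≤n S)

below : (n : ℕ) → ℕ → Subset n
below zero    j       = []
below (suc n) zero    = outside ∷ below n zero
below (suc n) (suc j) = inside ∷ below n j

∈-below⁻ : ∀ {j} {x : Fin n} → x ∈ below n j → toℕ x < j
∈-below⁻ {suc n} {suc j} {zero}  here      = s≤s z≤n
∈-below⁻ {suc n} {suc j} {suc x} (there m) = s≤s (∈-below⁻ m)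
∈-below⁻ {suc n} {zero}  {suc x} (there m) = ⊥-elim (n≮0 (∈-below⁻ m))

∈-below⁺ : ∀ {j} {x : Fin n} → toℕ x < j → x ∈ below n j
∈-below⁺ {suc n} {suc j} {zero}  _       = here
∈-below⁺ {suc n} {suc j} {suc x} (s≤s p) = there (∈-below⁺ p)

∉-below : ∀ {j} {x : Fin n} → toℕ x ≡ j → x ∉ below n j
∉-below x≡j = <-irrefl x≡j ∘ ∈-below⁻

below-zero : ∀ n → below n 0 ≡ ∅
below-zero zero    = refl
below-zero (suc n) = cong (outside ∷_) (below-zero n)

below-∪⁅⁆ : ∀ {j} (x : Fin n) → toℕ x ≡ j → below n j ∪ ⁅ x ⁆ ≡ below n (suc j)
below-∪⁅⁆ {suc n} zero    refl = cong (inside ∷_) (∪-identityʳ (below n 0))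
below-∪⁅⁆ {suc n} (suc x) refl = cong (inside ∷_) (below-∪⁅⁆ x refl)

∣below∣ : ∀ {j} → j ≤ n → ∣ below n j ∣ ≡ j
∣below∣ {zero}  {zero}  _       = refl
∣below∣ {suc n} {zero}  _       = ∣below∣ {n} z≤n
∣below∣ {suc n} {suc j} (s≤s p) = cong suc (∣below∣ p)

hopSource : ℕ → Fin n → Fin n
hopSource b w = fromℕ< (≤-<-trans (m∸n≤m (toℕ w) b) (toℕ<n w))

toℕ-hopSource : ∀ b (w : Fin n) → toℕ (hopSource b w) ≡ toℕ w ∸ b
toℕ-hopSource b w = toℕ-fromℕ< _

vertexAt : ∀ {i r} → i + suc r ≡ n → Fin n
vertexAt {i = i} e = fromℕ< (subst (i <_) e (m<m+n i (s≤s z≤n)))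

toℕ-vertexAt : ∀ {i r} (e : i + suc r ≡ n) → toℕ (vertexAt e) ≡ i
toℕ-vertexAt e = toℕ-fromℕ< _

-- The forces w ∸ b → w for w = i, …, n - 1 in increasing order; r counts the remaining ones.
hops : ∀ (b i r : ℕ) → i + r ≡ n → List (Fin n × Fin n)
hops b i zero    _ = []
hops b i (suc r) e = (hopSource b (vertexAt e) , vertexAt e) ∷ hops b (suc i) r (trans (sym (+-suc i r)) e)

hops-∈⁻ : ∀ {b i r} {e : i + r ≡ n} {v w} → (v , w) ∈ₗ hops b i r e → v ≡ hopSource b w × i ≤ toℕ w
hops-∈⁻ {r = suc r} {e} (here refl) = refl , ≤-reflexive (sym (toℕ-vertexAt e))
hops-∈⁻ {r = suc r}     (there m)   with v≡ , 1+i≤w ← hops-∈⁻ m = v≡ , <⇒≤ 1+i≤w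

hops-∈⁺ : ∀ {b i r} (e : i + r ≡ n) {w} → i ≤ toℕ w → (hopSource b w , w) ∈ₗ hops b i r e
hops-∈⁺ {i = i} {zero} e {w} i≤w =
  ⊥-elim (≤⇒≯ i≤w (subst (toℕ w <_) (trans (sym e) (+-identityʳ i)) (toℕ<n w)))
hops-∈⁺ {b = b} {i} {suc r} e {w} i≤w with m≤n⇒m<n∨m≡n i≤w
... | inj₁ i<w = there (hops-∈⁺ _ i<w)
... | inj₂ i≡w = here (cong (λ u → hopSource b u , u) (toℕ-injective (trans (sym i≡w) (sym (toℕ-vertexAt e)))))

hops-chrono : ∀ {b i r} (e : i + r ≡ n) → 1 ≤ b → b ≤ i →
  Chrono (edgeless n) (below n i) (below n (i ∸ b)) (hops b i r e)
hops-chrono {n} {i = i} {zero} e _ _ =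
  done λ _ w (_ , w∉S , _) → w∉S (∈-below⁺ (subst (toℕ w <_) (trans (sym e) (+-identityʳ i)) (toℕ<n w)))
hops-chrono {n} {b} {i} {suc r} e 1≤b b≤i =
  step (∈-below⁺ (subst (_< i) (sym source≡) (∸-monoʳ-< 1≤b b≤i)) ,
        ∉-below (toℕ-vertexAt e) ,
        ∉-below source≡ ,
        λ _ ())
       (subst₂ (λ S D → Chrono (edgeless n) S D (hops b (suc i) r (trans (sym (+-suc i r)) e)))
         (sym (below-∪⁅⁆ (vertexAt e) (toℕ-vertexAt e)))
         (trans (cong (below n) (+-∸-assoc 1 b≤i)) (sym (below-∪⁅⁆ _ source≡)))
         (hops-chrono _ 1≤b (m≤n⇒m≤1+n b≤i)))
  where
  source≡ : toℕ (hopSource b (vertexAt e)) ≡ i ∸ b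
  source≡ = trans (toℕ-hopSource b _) (cong (_∸ b) (toℕ-vertexAt e))

hopSource+b≡ : ∀ {b} {w : Fin n} → b ≤ toℕ w → toℕ (hopSource b w) + b ≡ toℕ w
hopSource+b≡ {b = b} {w} b≤w = trans (cong (_+ b) (toℕ-hopSource b w)) (m∸n+n≡m b≤w)

module EdgelessHopping {n b : ℕ} (1≤b : 1 ≤ b) (b≤n : b ≤ n) where

  forces : List (Fin n × Fin n)
  forces = hops b b (n ∸ b) (m+[n∸m]≡n b≤n)

  forces-chrono : IsSetOfForces (edgeless n) (below n b) forces
  forces-chrono = subst (λ D → Chrono (edgeless n) (below n b) D forces)
    (trans (cong (below n) (n∸n≡0 b)) (below-zero n)) (hops-chrono _ 1≤b ≤-refl)

  blueBy⇒ : ∀ t x → BlueBy (edgeless n) (below n b) forces t x → toℕ x < suc t * b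
  blueBy⇒ zero    x p        = subst (toℕ x <_) (sym (+-identityʳ b)) (∈-below⁻ p)
  blueBy⇒ (suc t) x (inj₁ p) = <-≤-trans (blueBy⇒ t x p) (m≤n+m (suc t * b) b)
  blueBy⇒ (suc t) x (inj₂ (_ , m , p , _)) with refl , b≤x ← hops-∈⁻ m =
    subst (_< b + suc t * b) (hopSource+b≡ b≤x)
      (subst (toℕ (hopSource b x) + b <_) (+-comm (suc t * b) b) (+-monoˡ-< b (blueBy⇒ t _ p)))

  ⇒blueBy : ∀ t x → toℕ x < suc t * b → BlueBy (edgeless n) (below n b) forces t x
  ⇒blueBy zero    x x<b = ∈-below⁺ (subst (toℕ x <_) (+-identityʳ b) x<b)
  ⇒blueBy (suc t) x x<   with toℕ x <? suc t * b
  ... | yes x<′ = inj₁ (⇒blueBy t x x<′)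
  ... | no  x≮  = inj₂ (hopSource b x , hops-∈⁺ _ b≤x , ⇒blueBy t _ source< , x≮ ∘ blueBy⇒ t x , λ _ ())
    where
    b≤x : b ≤ toℕ x
    b≤x = ≤-trans (m≤n*m b (suc t)) (≮⇒≥ x≮)
    source< : toℕ (hopSource b x) < suc t * b
    source< = +-cancelʳ-< b _ _ (subst (_< suc t * b + b) (sym (hopSource+b≡ b≤x))
                                   (subst (toℕ x <_) (+-comm b (suc t * b)) x<))

  forces-allBlueBy : ∀ {t} → n ≤ suc t * b → AllBlueBy (edgeless n) (below n b) forces t
  forces-allBlueBy {t} n≤ w = ⇒blueBy t w (<-≤-trans (toℕ<n w) n≤)

edgeless-throttling : ∀ {n c b t} → 1 ≤ b → b ≤ n → n ≤ suc t * b →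
  IsCeilTwoSqrt n c → suc (b + t) ≡ c → IsHoppingThrottling (edgeless n) (b + t)
edgeless-throttling {n} {b = b} {t} 1≤b b≤n n≤ ceil refl =
  (below n b , forces , t , forces-chrono , (forces-allBlueBy n≤ , fastest) , cong (_+ t) (∣below∣ b≤n)) ,
  λ B fs t′ chrono (blue , _) → s≤s⁻¹ (ceil2√≤suc[size+time] (edgeless n) B fs t′ ceil chrono blue)
  where
  open EdgelessHopping 1≤b b≤n
  fastest : ∀ s → AllBlueBy (edgeless n) (below n b) forces s → t ≤ s
  fastest s blue = +-cancelˡ-≤ b t s (s≤s⁻¹ (subst (λ k → suc (b + t) ≤ suc (k + s)) (∣below∣ b≤n)
                     (ceil2√≤suc[size+time] (edgeless n) (below n b) forces s ceil forces-chrono blue)))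

proposition3p13 : (α : ℕ) → 1 ≤ α →
    Σ ℕ (λ n → Σ (Graph n) (λ G → IsIndependenceNumber G α ×
      Σ ℕ (λ k → IsHoppingThrottling G k ×
        Σ ℕ (λ c → IsCeilTwoSqrt α c × k + 1 + α ≡ n + c))))
proposition3p13 α 1≤α with c , ceil ← ceil2√-exists α
                         with b , t , 1≤b , b≤α , α≤ , 1+b+t≡c ← ceil2√-split 1≤α ceil =
  α , edgeless α , edgeless-independenceNumber α ,
  b + t , edgeless-throttling 1≤b b≤α α≤ ceil 1+b+t≡c ,
  c , ceil , size-balance
  where
  open ≡-Reasoning
  size-balance : b + t + 1 + α ≡ α + c
  size-balance = begin
    b + t + 1 + α   ≡⟨ +-comm (b + t + 1) α ⟩
    α + (b + t + 1) ≡⟨ cong (α +_) (+-comm (b + t) 1) ⟩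
    α + suc (b + t) ≡⟨ cong (α +_) 1+b+t≡c ⟩
    α + c           ∎
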